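{- Let $n\ge0$. For every $(\tilde\gamma,\tilde\sigma)\in\mathcal{CP}'(n)$ with $\ell(\tilde\gamma)>\ell_e(\tilde\gamma)$, we have $g\circ f((\tilde\gamma,\tilde\sigma))=(\tilde\gamma,\tilde\sigma)$.
   Context: Partitions are finite multisets of positive integers; parts of size $0$ are discarded. For a partition $\pi$: $\ell(\pi)$ is its largest part ($0$ if $\pi$ is empty); $\ell_e(\pi)$ is its largest even part ($0$ if $\pi$ has no even parts); $s(\pi)$ is its smallest part. $\mathcal{CP}'(n)$ is the set of pairs of partitions $(\tilde\gamma,\tilde\sigma)$ with $|\tilde\gamma|+|\tilde\sigma|=n$ such that all parts of $\tilde\sigma$ are odd, every part of $\tilde\sigma$ is at least $\ell(\tilde\gamma)+\ell_e(\tilde\gamma)$, and $\tilde\gamma$ satisfies one of the following: ($o$) the largest part $\ell(\tilde\gamma)$ is odd and is the only part size of $\tilde\gamma$ with odd multiplicity; ($e$) either $\tilde\gamma$ has an even part and $\ell_e(\tilde\gamma)$ is the only part size with odd multiplicity, or $\tilde\gamma$ has no even parts and every part size has even multiplicity (including $\tilde\gamma$ empty). Define $o(\tilde\gamma)=\ell(\tilde\gamma)$ in case ($o$) and $o(\tilde\gamma)=\ell_e(\tilde\gamma)$ in case ($e$). For $(\tilde\gamma,\tilde\sigma)\in\mathcal{CP}'(n)$ with $\ell(\tilde\gamma)\neq\ell_e(\tilde\gamma)$, $f((\tilde\gamma,\tilde\sigma))$ is obtained by removing one copy of $\ell(\tilde\gamma)$ and one copy of $\ell_e(\tilde\gamma)$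 from $\tilde\gamma$ (nothing is removed for a value $0$) and adding a part $\ell(\tilde\gamma)+\ell_e(\tilde\gamma)$ to $\tilde\sigma$. For $(\tilde\gamma,\tilde\sigma)\in\mathcal{CP}'(n)$ with $\tilde\sigma$ nonempty, $g((\tilde\gamma,\tilde\sigma))$ is obtained by removing one copy of $s(\tilde\sigma)$ from $\tilde\sigma$ and adding to $\tilde\gamma$ the two parts $o(\tilde\gamma)$ and $s(\tilde\sigma)-o(\tilde\gamma)$ (parts equal to $0$ are not added). -}

module Defs where

open import Data.Nat using (ℕ; zero; suc; _+_; _⊔_; _⊓_; _<_; _≟_)
open import Data.Nat.DivMod using (_%_)
open import Data.Bool using (Bool; true; false; if_then_else_; _∧_)
open import Data.List using (List; []; _∷_)
open import Data.Nat.ListAction using (sum)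
open import Data.List.Relation.Unary.All using (All)
open import Data.List.Relation.Binary.Permutation.Propositional using (_↭_)
open import Data.Product using (_×_; _,_; proj₁; proj₂)
open import Data.Sum using (_⊎_)
open import Relation.Binary.PropositionalEquality using (_≡_)
open import Relation.Nullary using (¬_; does)
open import Function.Bundles using (_⇔_)

-- A partition is a finite multiset of positive integers, represented by a
-- list of its parts (order irrelevant; equality of partitions is _↭_).
Partition : Set
Partition = List ℕ

IsPartition : Partition → Set
IsPartition π = All (λ k → 0 < k) π

isEven : ℕ → Bool
isEven n = does ((n % 2) ≟ 0)

Even : ℕ → Set
Even n = n % 2 ≡ 0

Odd : ℕ → Set
Odd n = n % 2 ≡ 1

ℓ : Partition → ℕ
ℓ [] = 0
ℓ (x ∷ xs) = x ⊔ ℓ xs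

ℓₑ : Partition → ℕ
ℓₑ [] = 0
ℓₑ (x ∷ xs) = if isEven x then x ⊔ ℓₑ xs else ℓₑ xs

-- s(π): smallest part (only meaningful for nonempty π)
s : Partition → ℕ
s [] = 0
s (x ∷ []) = x
s (x ∷ y ∷ ys) = x ⊓ s (y ∷ ys)

mult : ℕ → Partition → ℕ
mult k [] = 0
mult k (x ∷ xs) = if does (x ≟ k) then suc (mult k xs) else mult k xs

remove : ℕ → Partition → Partition
remove k [] = []
remove k (x ∷ xs) = if does (x ≟ k) then xs else x ∷ remove k xs

add : ℕ → Partition → Partition
add zero π = π
add (suc k) π = suc k ∷ π

CaseO : Partition → Set
CaseO γ = Odd (ℓ γ) × (∀ k → Odd (mult k γ) ⇔ (k ≡ ℓ γ))

HasEvenPart : Partition → Set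
HasEvenPart γ = All (λ k → Odd k) γ → Data.Empty.⊥
  where import Data.Empty

CaseE : Partition → Set
CaseE γ =
  (HasEvenPart γ × (∀ k → Odd (mult k γ) ⇔ (k ≡ ℓₑ γ)))
  ⊎ (All (λ k → Odd k) γ × (∀ k → Even (mult k γ)))

CP' : ℕ → Partition × Partition → Set
CP' n (γ , σ) =
  IsPartition γ × IsPartition σ
  × (sum γ + sum σ ≡ n)
  × All (λ k → Odd k) σ
  × All (λ k → ℓ γ + ℓₑ γ Data.Nat.≤ k) σ
  × (CaseO γ ⊎ CaseE γ)

-- o(γ): ℓ(γ) in case (o), ℓₑ(γ) in case (e).  Cases (o) and (e) are mutually
-- exclusive, and case (o) holds (for γ satisfying (o) or (e)) exactly when
-- ℓ(γ) is odd with odd multiplicity; this test is used to select the case.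
o : Partition → ℕ
o γ = if (not (isEven (ℓ γ)) ∧ not (isEven (mult (ℓ γ) γ))) then ℓ γ else ℓₑ γ
  where open Data.Bool using (not)

f : Partition × Partition → Partition × Partition
f (γ , σ) = (remove (ℓₑ γ) (remove (ℓ γ) γ) , add (ℓ γ + ℓₑ γ) σ)

g : Partition × Partition → Partition × Partition
g (γ , σ) = (add (s σ Data.Nat.∸ o γ) (add (o γ) γ) , remove (s σ) σ)

_≈ₚ_ : Partition × Partition → Partition × Partition → Set
(γ , σ) ≈ₚ (γ' , σ') = (γ ↭ γ') × (σ ↭ σ')

{-# OPTIONS --safe #-}
-- f moves ℓ = ℓ(γ) and ℓₑ = ℓₑ(γ) out of γ, leaving γ', and into the new smallest
-- part ℓ + ℓₑ of σ; g takes that part back out and splits it as o(γ') + (ℓ + ℓₑ ∸ o(γ')).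
-- So it suffices that o(γ') ∈ {ℓ, ℓₑ}.  Removing one copy each of ℓ and ℓₑ flips the
-- parity of both multiplicities.  In case (o) the odd multiplicity moves from ℓ to ℓₑ,
-- so γ' is in case (e) with ℓₑ(γ') = ℓₑ; in case (e) it moves from ℓₑ to ℓ, which is
-- odd since ℓ > ℓₑ, so γ' is in case (o) with ℓ(γ') = ℓ.
module Submission where

open import Defs
open import Data.Nat using (ℕ; zero; suc; _+_; _∸_; _⊔_; _%_; _≤_; _<_; _>_; _≟_; z≤n; z<s)
open import Data.Nat.Properties
open import Data.Bool using (Bool; true; false; not; _∧_; if_then_else_)
open import Data.List using ([]; _∷_)
open import Data.List.Relation.Unary.All using (All; []; _∷_)
open import Data.List.Relation.Binary.Permutation.Propositional using (_↭_; ↭-refl; ↭-reflexive; ↭-prep; ↭-swap; ↭-trans; ↭-sym)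
open import Data.Product using (_×_; _,_)
open import Data.Sum using (_⊎_; inj₁; inj₂; map)
open import Function.Bundles using (_⇔_; module Equivalence)
open import Relation.Binary.PropositionalEquality using (_≡_; _≢_; refl; sym; trans; cong; subst; subst₂; cong₂)
open import Relation.Nullary using (Dec; does; ¬_; yes; no; contradiction)
open import Relation.Nullary.Decidable using (dec-true; dec-false)

open Equivalence using (to; from)

parity : ∀ n → Even n ⊎ Odd n
parity 0 = inj₁ refl
parity 1 = inj₂ refl
parity (suc (suc n)) = parity n

even⇒¬odd : ∀ {n} → Even n → ¬ Odd n
even⇒¬odd e o = 0≢1+n (trans (sym e) o)

odd⇒even-suc : ∀ n → Odd n → Even (suc n)
odd⇒even-suc 0 ()
odd⇒even-suc 1 _ = refl
odd⇒even-suc (suc (suc n)) o = odd⇒even-suc n o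

even-suc⇒odd : ∀ n → Even (suc n) → Odd n
even-suc⇒odd 0 ()
even-suc⇒odd 1 _ = refl
even-suc⇒odd (suc (suc n)) e = even-suc⇒odd n e

odd⇒pos : ∀ {n} → Odd n → 0 < n
odd⇒pos {zero} ()
odd⇒pos {suc n} _ = z<s

isEven-even : ∀ n → Even n → isEven n ≡ true
isEven-even n = dec-true ((n % 2) ≟ 0)

isEven-odd : ∀ n → Odd n → isEven n ≡ false
isEven-odd n o = dec-false ((n % 2) ≟ 0) (λ e → even⇒¬odd {n} e o)

if-yes : ∀ {p} {P : Set p} {A : Set} (P? : Dec P) {a b : A} → P → (if does P? then a else b) ≡ a
if-yes P? p rewrite dec-true P? p = refl

if-no : ∀ {p} {P : Set p} {A : Set} (P? : Dec P) {a b : A} → ¬ P → (if does P? then a else b) ≡ b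
if-no P? ¬p rewrite dec-false P? ¬p = refl

mult-here : ∀ k xs → mult k (k ∷ xs) ≡ suc (mult k xs)
mult-here k xs = if-yes (k ≟ k) refl

mult-there : ∀ {k x} xs → x ≢ k → mult k (x ∷ xs) ≡ mult k xs
mult-there {k} {x} xs = if-no (x ≟ k)

mult-∷-cong : ∀ k x ys zs → mult k ys ≡ mult k zs → mult k (x ∷ ys) ≡ mult k (x ∷ zs)
mult-∷-cong k x _ _ = cong (λ m → if does (x ≟ k) then suc m else m)

remove-here : ∀ k xs → remove k (k ∷ xs) ≡ xs
remove-here k xs = if-yes (k ≟ k) refl

remove-there : ∀ {k x} xs → x ≢ k → remove k (x ∷ xs) ≡ x ∷ remove k xs
remove-there {k} {x} xs = if-no (x ≟ k)

ℓₑ-even-cons : ∀ x xs → Even x → ℓₑ (x ∷ xs) ≡ x ⊔ ℓₑ xs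
ℓₑ-even-cons x xs = if-yes ((x % 2) ≟ 0)

ℓₑ-odd-cons : ∀ x xs → Odd x → ℓₑ (x ∷ xs) ≡ ℓₑ xs
ℓₑ-odd-cons x xs o = if-no ((x % 2) ≟ 0) (λ e → even⇒¬odd {x} e o)

infix 4 _∈ₚ_

_∈ₚ_ : ℕ → Partition → Set
k ∈ₚ π = 0 < mult k π

∈ₚ-here : ∀ x xs → x ∈ₚ x ∷ xs
∈ₚ-here x xs = subst (0 <_) (sym (mult-here x xs)) z<s

∈ₚ-there : ∀ {k} x xs → k ∈ₚ xs → k ∈ₚ x ∷ xs
∈ₚ-there {k} x xs k∈xs with x ≟ k
... | yes refl = ∈ₚ-here x xs
... | no x≢k = subst (0 <_) (sym (mult-there xs x≢k)) k∈xs

∈ₚ-tail : ∀ {k x} xs → x ≢ k → k ∈ₚ x ∷ xs → k ∈ₚ xs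
∈ₚ-tail xs x≢k = subst (0 <_) (mult-there xs x≢k)

⊔-∈ₚ : ∀ x {y} xs → 0 < x ⊔ y → (0 < y → y ∈ₚ xs) → x ⊔ y ∈ₚ x ∷ xs
⊔-∈ₚ x {y} xs x⊔y>0 y∈xs with ⊔-sel x y
... | inj₁ x⊔y≡x = subst (_∈ₚ x ∷ xs) (sym x⊔y≡x) (∈ₚ-here x xs)
... | inj₂ x⊔y≡y =
  subst (_∈ₚ x ∷ xs) (sym x⊔y≡y) (∈ₚ-there x xs (y∈xs (subst (0 <_) x⊔y≡y x⊔y>0)))

mult-remove : ∀ k xs → k ∈ₚ xs → mult k xs ≡ suc (mult k (remove k xs))
mult-remove k (x ∷ xs) k∈xs with x ≟ k
... | yes refl rewrite remove-here x xs = mult-here x xs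
... | no x≢k rewrite remove-there xs x≢k =
  trans (mult-there xs x≢k)
        (trans (mult-remove k xs (∈ₚ-tail xs x≢k k∈xs)) (cong suc (sym (mult-there (remove k xs) x≢k))))

mult-remove-≢ : ∀ {j k} xs → j ≢ k → mult j (remove k xs) ≡ mult j xs
mult-remove-≢ [] _ = refl
mult-remove-≢ {j} {k} (x ∷ xs) j≢k with x ≟ k
... | yes refl rewrite remove-here x xs = sym (mult-there {j} xs (λ x≡j → j≢k (sym x≡j)))
... | no x≢k rewrite remove-there xs x≢k = mult-∷-cong j x (remove k xs) xs (mult-remove-≢ xs j≢k)

All-remove : ∀ {P : ℕ → Set} k {xs} → All P xs → All P (remove k xs)
All-remove k [] = []
All-remove k {x ∷ xs} (px ∷ pxs) with x ≟ k
... | yes refl rewrite remove-here x xs = pxs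
... | no x≢k rewrite remove-there xs x≢k = px ∷ All-remove k pxs

remove-zero : ∀ {π} → IsPartition π → remove 0 π ≡ π
remove-zero [] = refl
remove-zero {x ∷ xs} (x>0 ∷ xs>0) rewrite remove-there xs (>⇒≢ x>0) = cong (x ∷_) (remove-zero xs>0)

remove-↭ : ∀ k xs → k ∈ₚ xs → xs ↭ k ∷ remove k xs
remove-↭ k (x ∷ xs) k∈xs with x ≟ k
... | yes refl rewrite remove-here x xs = ↭-refl
... | no x≢k rewrite remove-there xs x≢k =
  ↭-trans (↭-prep x (remove-↭ k xs (∈ₚ-tail xs x≢k k∈xs))) (↭-swap x k ↭-refl)

add-remove-↭ : ∀ k {π} → IsPartition π → (0 < k → k ∈ₚ π) → π ↭ add k (remove k π)
add-remove-↭ zero π>0 _ rewrite remove-zero π>0 = ↭-refl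
add-remove-↭ (suc k) _ k∈π = remove-↭ (suc k) _ (k∈π z<s)

add-∷-↭ : ∀ k x xs → add k (x ∷ xs) ↭ x ∷ add k xs
add-∷-↭ zero x xs = ↭-refl
add-∷-↭ (suc k) x xs = ↭-swap (suc k) x ↭-refl

add-split-↭ : ∀ {a b c} xs → 0 < a → c ≡ b ⊎ c ≡ a → add (a + b ∸ c) (add c xs) ↭ a ∷ add b xs
add-split-↭ {suc a} {b} xs _ (inj₁ refl) rewrite m+n∸n≡m (suc a) b = ↭-refl
add-split-↭ {suc a} {b} xs _ (inj₂ refl) rewrite m+n∸m≡n (suc a) b = add-∷-↭ b (suc a) xs

ℓ-∈ₚ : ∀ xs → 0 < ℓ xs → ℓ xs ∈ₚ xs
ℓ-∈ₚ (x ∷ xs) ℓ>0 = ⊔-∈ₚ x xs ℓ>0 (ℓ-∈ₚ xs)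

∈ₚ-∷⇒≤⊔ : ∀ {k} x {y} xs → k ∈ₚ x ∷ xs → (k ∈ₚ xs → k ≤ y) → k ≤ x ⊔ y
∈ₚ-∷⇒≤⊔ {k} x xs k∈x∷xs k≤y with x ≟ k
... | yes refl = m≤m⊔n x _
... | no x≢k = ≤-trans (k≤y (∈ₚ-tail xs x≢k k∈x∷xs)) (m≤n⊔m x _)

∈ₚ⇒≤ℓ : ∀ {k} xs → k ∈ₚ xs → k ≤ ℓ xs
∈ₚ⇒≤ℓ (x ∷ xs) k∈x∷xs = ∈ₚ-∷⇒≤⊔ x xs k∈x∷xs (∈ₚ⇒≤ℓ xs)

ℓ-remove-≤ : ∀ k xs → ℓ (remove k xs) ≤ ℓ xs
ℓ-remove-≤ k [] = z≤n
ℓ-remove-≤ k (x ∷ xs) with x ≟ k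
... | yes refl rewrite remove-here x xs = m≤n⊔m x _
... | no x≢k rewrite remove-there xs x≢k = ⊔-monoʳ-≤ x (ℓ-remove-≤ k xs)

⊔-pres : ∀ (P : ℕ → Set) x y → P x → P y → P (x ⊔ y)
⊔-pres P x y px py with ⊔-sel x y
... | inj₁ x⊔y≡x = subst P (sym x⊔y≡x) px
... | inj₂ x⊔y≡y = subst P (sym x⊔y≡y) py

ℓₑ-even : ∀ xs → Even (ℓₑ xs)
ℓₑ-even [] = refl
ℓₑ-even (x ∷ xs) with parity x
... | inj₁ x-even =
  subst Even (sym (ℓₑ-even-cons x xs x-even)) (⊔-pres Even x (ℓₑ xs) x-even (ℓₑ-even xs))
... | inj₂ x-odd = subst Even (sym (ℓₑ-odd-cons x xs x-odd)) (ℓₑ-even xs)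

ℓₑ-∈ₚ : ∀ xs → 0 < ℓₑ xs → ℓₑ xs ∈ₚ xs
ℓₑ-∈ₚ (x ∷ xs) ℓₑ>0 with parity x
... | inj₁ x-even =
  subst (_∈ₚ x ∷ xs) (sym eq) (⊔-∈ₚ x xs (subst (0 <_) eq ℓₑ>0) (ℓₑ-∈ₚ xs))
  where eq = ℓₑ-even-cons x xs x-even
... | inj₂ x-odd =
  subst (_∈ₚ x ∷ xs) (sym eq) (∈ₚ-there x xs (ℓₑ-∈ₚ xs (subst (0 <_) eq ℓₑ>0)))
  where eq = ℓₑ-odd-cons x xs x-odd

ℓₑ-≤-∷ : ∀ x xs → ℓₑ xs ≤ ℓₑ (x ∷ xs)
ℓₑ-≤-∷ x xs with parity x
... | inj₁ x-even = subst (ℓₑ xs ≤_) (sym (ℓₑ-even-cons x xs x-even)) (m≤n⊔m x _)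
... | inj₂ x-odd = ≤-reflexive (sym (ℓₑ-odd-cons x xs x-odd))

ℓₑ-∷-mono : ∀ x ys zs → ℓₑ ys ≤ ℓₑ zs → ℓₑ (x ∷ ys) ≤ ℓₑ (x ∷ zs)
ℓₑ-∷-mono x ys zs ys≤zs with parity x
... | inj₁ x-even =
  subst₂ _≤_ (sym (ℓₑ-even-cons x ys x-even)) (sym (ℓₑ-even-cons x zs x-even)) (⊔-monoʳ-≤ x ys≤zs)
... | inj₂ x-odd =
  subst₂ _≤_ (sym (ℓₑ-odd-cons x ys x-odd)) (sym (ℓₑ-odd-cons x zs x-odd)) ys≤zs

∈ₚ⇒≤ℓₑ : ∀ {k} xs → Even k → k ∈ₚ xs → k ≤ ℓₑ xs
∈ₚ⇒≤ℓₑ {k} (x ∷ xs) k-even k∈x∷xs with parity x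
... | inj₁ x-even =
  subst (k ≤_) (sym (ℓₑ-even-cons x xs x-even)) (∈ₚ-∷⇒≤⊔ x xs k∈x∷xs (∈ₚ⇒≤ℓₑ xs k-even))
... | inj₂ x-odd = ≤-trans (∈ₚ⇒≤ℓₑ xs k-even (∈ₚ-tail xs x≢k k∈x∷xs)) (ℓₑ-≤-∷ x xs)
  where
  x≢k : x ≢ k
  x≢k refl = even⇒¬odd {k} k-even x-odd

ℓₑ-remove-≤ : ∀ k xs → ℓₑ (remove k xs) ≤ ℓₑ xs
ℓₑ-remove-≤ k [] = z≤n
ℓₑ-remove-≤ k (x ∷ xs) with x ≟ k
... | yes refl = ≤-trans (≤-reflexive (cong ℓₑ (remove-here x xs))) (ℓₑ-≤-∷ x xs)
... | no x≢k =
  ≤-trans (≤-reflexive (cong ℓₑ (remove-there xs x≢k))) (ℓₑ-∷-mono x (remove k xs) xs (ℓₑ-remove-≤ k xs))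

All≤⇒≤s : ∀ {k} y ys → All (k ≤_) (y ∷ ys) → k ≤ s (y ∷ ys)
All≤⇒≤s y [] (k≤y ∷ []) = k≤y
All≤⇒≤s y (z ∷ zs) (k≤y ∷ k≤zs) = ⊓-glb k≤y (All≤⇒≤s z zs k≤zs)

s-add : ∀ {k σ} → 0 < k → All (k ≤_) σ → s (add k σ) ≡ k
s-add {suc k} {[]} _ _ = refl
s-add {suc k} {y ∷ ys} _ k≤σ = m≤n⇒m⊓n≡m (All≤⇒≤s y ys k≤σ)

remove-add : ∀ {k} σ → 0 < k → remove k (add k σ) ≡ σ
remove-add {suc k} σ _ = remove-here (suc k) σ

≤-of-pos : ∀ {m n} → (0 < m → m ≤ n) → m ≤ n
≤-of-pos {zero} _ = z≤n
≤-of-pos {suc m} m≤n = m≤n z<s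

o-select : Partition → Bool → Bool → ℕ
o-select π ℓ-even mult-even = if not ℓ-even ∧ not mult-even then ℓ π else ℓₑ π

o≡ℓ : ∀ π → Odd (ℓ π) → Odd (mult (ℓ π) π) → o π ≡ ℓ π
o≡ℓ π ℓ-odd mult-odd =
  cong₂ (o-select π) (isEven-odd (ℓ π) ℓ-odd) (isEven-odd (mult (ℓ π) π) mult-odd)

o≡ℓₑ : ∀ π → ¬ (Odd (ℓ π) × Odd (mult (ℓ π) π)) → o π ≡ ℓₑ π
o≡ℓₑ π ¬odd with parity (ℓ π) | parity (mult (ℓ π) π)
... | inj₁ ℓ-even | _ = cong₂ (o-select π) (isEven-even (ℓ π) ℓ-even) refl
... | inj₂ ℓ-odd | inj₁ mult-even =
  cong₂ (o-select π) (isEven-odd (ℓ π) ℓ-odd) (isEven-even (mult (ℓ π) π) mult-even)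
... | inj₂ ℓ-odd | inj₂ mult-odd = contradiction (ℓ-odd , mult-odd) ¬odd

even-mult : ∀ {π d k} → (∀ j → Odd (mult j π) ⇔ (j ≡ d)) → k ≢ d → Even (mult k π)
even-mult {π} {k = k} odd⇔≡d k≢d with parity (mult k π)
... | inj₁ mult-even = mult-even
... | inj₂ mult-odd = contradiction (to (odd⇔≡d k) mult-odd) k≢d

module LargestPartsRemoved {γ : Partition} (γ-partition : IsPartition γ) (ℓₑ<ℓ : ℓₑ γ < ℓ γ) where

  L E : ℕ
  L = ℓ γ
  E = ℓₑ γ

  γ' : Partition
  γ' = remove E (remove L γ)

  0<L : 0 < L
  0<L = m<n⇒0<n ℓₑ<ℓ

  L≢E : L ≢ E
  L≢E = >⇒≢ ℓₑ<ℓ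

  E≢L : E ≢ L
  E≢L = <⇒≢ ℓₑ<ℓ

  L-odd : Odd L
  L-odd with parity L
  ... | inj₂ L-odd = L-odd
  ... | inj₁ L-even = contradiction (∈ₚ⇒≤ℓₑ γ L-even (ℓ-∈ₚ γ 0<L)) (<⇒≱ ℓₑ<ℓ)

  E∈remove-L : 0 < E → E ∈ₚ remove L γ
  E∈remove-L 0<E = subst (0 <_) (sym (mult-remove-≢ γ E≢L)) (ℓₑ-∈ₚ γ 0<E)

  decomposition : γ ↭ L ∷ add E γ'
  decomposition = ↭-trans (remove-↭ L γ (ℓ-∈ₚ γ 0<L))
                          (↭-prep L (add-remove-↭ E (All-remove L γ-partition) E∈remove-L))

  mult-L : mult L γ ≡ suc (mult L γ')
  mult-L = trans (mult-remove L γ (ℓ-∈ₚ γ 0<L)) (cong suc (sym (mult-remove-≢ (remove L γ) L≢E)))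

  mult-E : 0 < E → mult E γ ≡ suc (mult E γ')
  mult-E 0<E = trans (sym (mult-remove-≢ γ E≢L)) (mult-remove E (remove L γ) (E∈remove-L 0<E))

  mult-other : ∀ {k} → k ≢ L → k ≢ E → mult k γ' ≡ mult k γ
  mult-other k≢L k≢E = trans (mult-remove-≢ (remove L γ) k≢E) (mult-remove-≢ γ k≢L)

  ℓₑ-γ'≤E : ℓₑ γ' ≤ E
  ℓₑ-γ'≤E = ≤-trans (ℓₑ-remove-≤ E (remove L γ)) (ℓₑ-remove-≤ L γ)

  ℓ-γ'≤L : ℓ γ' ≤ L
  ℓ-γ'≤L = ≤-trans (ℓ-remove-≤ E (remove L γ)) (ℓ-remove-≤ L γ)

  o-caseO : CaseO γ → o γ' ≡ E
  o-caseO (_ , odd⇔≡L) = trans (o≡ℓₑ γ' ℓ-γ'-not-both-odd) (≤-antisym ℓₑ-γ'≤E E≤ℓₑ-γ')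
    where
    ℓ-γ'-not-both-odd : ¬ (Odd (ℓ γ') × Odd (mult (ℓ γ') γ'))
    ℓ-γ'-not-both-odd (k-odd , mult-odd) with ℓ γ' ≟ L
    ... | yes k≡L = even⇒¬odd {mult L γ} mult-L-even (from (odd⇔≡L L) refl)
      where
      mult-L-even : Even (mult L γ)
      mult-L-even =
        subst Even (sym mult-L) (odd⇒even-suc (mult L γ') (subst (λ k → Odd (mult k γ')) k≡L mult-odd))
    ... | no k≢L = k≢L (to (odd⇔≡L _) (subst Odd (mult-other k≢L k≢E) mult-odd))
      where
      k≢E : ℓ γ' ≢ E
      k≢E k≡E = even⇒¬odd {ℓ γ'} (subst Even (sym k≡E) (ℓₑ-even γ)) k-odd
    E∈γ' : 0 < E → E ∈ₚ γ'
    E∈γ' 0<E =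
      odd⇒pos (even-suc⇒odd (mult E γ') (subst Even (mult-E 0<E) (even-mult {γ} odd⇔≡L E≢L)))
    E≤ℓₑ-γ' : E ≤ ℓₑ γ'
    E≤ℓₑ-γ' = ≤-of-pos (λ 0<E → ∈ₚ⇒≤ℓₑ γ' (ℓₑ-even γ) (E∈γ' 0<E))

  o-caseE : CaseE γ → o γ' ≡ L
  o-caseE caseE =
    trans (o≡ℓ γ' (subst Odd (sym ℓ-γ'≡L) L-odd)
                  (subst (λ k → Odd (mult k γ')) (sym ℓ-γ'≡L) mult-L-odd))
          ℓ-γ'≡L
    where
    mult-L-even : CaseE γ → Even (mult L γ)
    mult-L-even (inj₁ (_ , odd⇔≡E)) = even-mult {γ} odd⇔≡E L≢E
    mult-L-even (inj₂ (_ , all-even)) = all-even L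
    mult-L-odd : Odd (mult L γ')
    mult-L-odd = even-suc⇒odd (mult L γ') (subst Even mult-L (mult-L-even caseE))
    ℓ-γ'≡L : ℓ γ' ≡ L
    ℓ-γ'≡L = ≤-antisym ℓ-γ'≤L (∈ₚ⇒≤ℓ γ' (odd⇒pos mult-L-odd))

lemma2 : (n : ℕ) → (γ σ : Partition) → CP' n (γ , σ) → ℓ γ > ℓₑ γ →
    g (f (γ , σ)) ≈ₚ (γ , σ)
lemma2 _ γ σ (γ-partition , _ , _ , _ , σ≥ℓ+ℓₑ , γ-case) ℓₑ<ℓ = γ-restored , σ-restored
  where
  open LargestPartsRemoved γ-partition ℓₑ<ℓ
  0<L+E : 0 < L + E
  0<L+E = <-≤-trans 0<L (m≤m+n L E)
  s≡L+E : s (add (L + E) σ) ≡ L + E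
  s≡L+E = s-add 0<L+E σ≥ℓ+ℓₑ
  o∈LE : o γ' ≡ E ⊎ o γ' ≡ L
  o∈LE = map o-caseO o-caseE γ-case
  γ-restored : add (s (add (L + E) σ) ∸ o γ') (add (o γ') γ') ↭ γ
  γ-restored rewrite s≡L+E = ↭-trans (add-split-↭ γ' 0<L o∈LE) (↭-sym decomposition)
  σ-restored : remove (s (add (L + E) σ)) (add (L + E) σ) ↭ σ
  σ-restored rewrite s≡L+E = ↭-reflexive (remove-add σ 0<L+E)
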